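{- Let $n,k,r$ be positive integers with $r\geq2$ and $n\geq rk$, and let $n',k'$ be positive integers with $\gcd(n',k')=1$ and $n/k=n'/k'$. For $0\leq j\leq n-1$ let $P^j=\{j+n,\ j+\lceil n/k\rceil,\ j+\lceil 2n/k\rceil,\ldots,j+\lceil (k-1)n/k\rceil\}$, with elements taken modulo $n$ (representatives in $[n]$). Then the $P^j$ are exactly $n'$ distinct $r$-stable $k$-polygons, and the subgraph $G_{\mathrm{equi}}$ of $\mathrm{IG}_{n,k}^{(r)}$ induced by them is a circular clique of size $n'/k'$, i.e. isomorphic to $K_{n'/k'}$.
   Context: Write $[n]=\{1,\ldots,n\}$ and view its elements as placed in clockwise order on a circle; a $k$-subset of $[n]$ is called a $k$-polygon. A $k$-polygon $P$ is $r$-stable if the cyclic distance (on $\mathbb{Z}/n\mathbb{Z}$) between any two distinct points of $P$ is at least $r$. Two $k$-polygons $P=\{p_1<\cdots<p_k\}$ and $Q=\{q_1<\cdots<q_k\}$ interlace if $p_1<q_1<\cdots<p_k<q_k$ or $q_1<p_1<\cdots<q_k<p_k$. The graph $\mathrm{IG}_{n,k}^{(r)}$ has as vertices the $r$-stable $k$-polygons on $[n]$, adjacent iff they interlace. For positive integers $a\geq 2b$, the circular clique $K_{a/b}$ has vertex set $\mathbb{Z}/a\mathbb{Z}$, two vertices adjacent iff their cyclic distance is at least $b$. -}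

module Defs where

open import Data.Nat using (ℕ; zero; suc; _+_; _*_; _∸_; _≤_; _<_; ∣_-_∣; _⊓_; NonZero)
open import Data.Nat.DivMod using (_/_; _%_; m%n<n)
open import Data.Fin using (Fin; toℕ; fromℕ<) renaming (_<_ to _<ᶠ_)
import Data.Fin as F
open import Data.Fin.Subset using (Subset; _∈_; ⁅_⁆; ⋃)
open import Data.List using (map; allFin)
open import Data.Product using (Σ; ∃; _×_)
open import Relation.Binary.PropositionalEquality using (_≡_; _≢_)
open import Function.Bundles using (_⇔_)

-- Convention: the point p ∈ [n] = {1,…,n} is represented by the index
-- (p - 1) : Fin n.  This preserves the order 1 < 2 < … < n.

cdist : ∀ {n} → Fin n → Fin n → ℕ
cdist {n} x y = ∣ toℕ x - toℕ y ∣ ⊓ (n ∸ ∣ toℕ x - toℕ y ∣)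

IsPolygon : ∀ {n} → ℕ → Subset n → Set
IsPolygon k P = Data.Fin.Subset.∣ P ∣ ≡ k

Stable : ∀ {n} → ℕ → Subset n → Set
Stable r P = ∀ x y → x ∈ P → y ∈ P → x ≢ y → r ≤ cdist x y

Enumerates : ∀ {n k} → Subset n → (Fin k → Fin n) → Set
Enumerates {n} {k} P f =
  (∀ (i j : Fin k) → i <ᶠ j → f i <ᶠ f j) × (∀ x → (x ∈ P) ⇔ ∃ λ i → f i ≡ x)

Alternates : ∀ {n k} → Subset n → Subset n → Set
Alternates {n} {k} P Q = Σ (Fin k → Fin n) λ p → Σ (Fin k → Fin n) λ q →
  Enumerates P p × Enumerates Q q ×
  (∀ i → p i <ᶠ q i) × (∀ (i j : Fin k) → toℕ j ≡ suc (toℕ i) → q i <ᶠ p j)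

Interlace : ∀ {n} → ℕ → Subset n → Subset n → Set
Interlace {n} k P Q = Alternates {n} {k} P Q Data.Sum.⊎ Alternates {n} {k} Q P
  where import Data.Sum

-- adjacency in the circular clique K_{a/b} on vertex set ℤ/aℤ = Fin a
CircAdj : ∀ {a} → ℕ → Fin a → Fin a → Set
CircAdj b x y = b ≤ cdist x y

ceilDiv : (a b : ℕ) → .{{NonZero b}} → ℕ
ceilDiv a b = (a + b ∸ 1) / b

offset : (n k : ℕ) → .{{NonZero k}} → Fin k → ℕ
offset n k F.zero = n
offset n k (F.suc i) = ceilDiv (suc (toℕ i) * n) k

-- the point m (mod n) with representative in [n], as an index in Fin n
pointMod : (n : ℕ) → .{{NonZero n}} → ℕ → Fin n
pointMod n m = fromℕ< (m%n<n (m ∸ 1) n)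

Pequi : (n k : ℕ) → .{{NonZero n}} → .{{NonZero k}} → Fin n → Subset n
Pequi n k j = ⋃ (map (λ i → ⁅ pointMod n (toℕ j + offset n k i) ⁆) (allFin k))

-- Write n / k = N / K in lowest terms; then N divides n and k N = n K. For a phase D < N the points
-- ⌊ (D + m N) / K ⌋, m < k, form an r-stable k-polygon: consecutive points are at least
-- ⌊ N / K ⌋ ≥ r apart, also across the wrap-around because k steps of N / K make exactly one turn.
-- A point t lies on this polygon iff D − t K mod N is below K. Comparing this criterion with the
-- ceilings ⌈ i n / k ⌉ shows that P^j is the polygon of phase j K − 1 mod N; as K is invertible
-- modulo N every phase arises, and distinct phases are separated by some point of the criterion.
-- Two polygons whose phases are at circular distance at least K alternate, while for closer phases
-- the criterion yields a common point, which alternating polygons cannot share.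

module Submission where

open import Defs
open import Data.Nat using (ℕ; _*_; _≤_; NonZero)
open import Data.Nat.GCD using (gcd)
open import Data.Fin using (Fin)
open import Data.Product using (Σ; ∃; _×_)
open import Relation.Binary.PropositionalEquality using (_≡_; _≢_)
open import Function.Bundles using (_⇔_)

open import Data.Nat
open import Data.Nat.Properties
open import Data.Nat.DivMod
open import Data.Nat.Divisibility using (_∣_; divides; ∣⇒≤)
open import Data.Nat.Coprimality using (Coprime; gcd≡1⇒coprime; coprime-divisor; coprime-Bézout)
open import Data.Nat.GCD using (module Bézout)
open import Data.Nat.Tactic.RingSolver using (solve-∀)
open import Data.Fin using (toℕ; fromℕ<) renaming (zero to fzero; suc to fsuc; _<_ to _<ᶠ_)
open import Data.Fin.Properties using (toℕ-fromℕ<; toℕ-injective; toℕ<n) renaming (suc-injective to fsuc-injective)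
open import Data.Fin.Subset using (Subset; _∈_; _∉_; _⊆_; ⁅_⁆; _∪_; ⋃; ∣_∣) renaming (⊥ to ∅)
open import Data.Fin.Subset.Properties using (⊆-antisym; x∈⁅x⁆; x∈⁅y⁆⇒x≡y; x∈p∪q⁺; x∈p∪q⁻; ∉⊥; ∣⊥∣≡0; ∪-identityˡ)
open import Data.List using (map; allFin; tabulate)
open import Data.List.Properties using (map-tabulate)
open import Data.Vec using (_∷_; here; there)
open import Data.Bool using (true; false)
open import Data.Product using (_,_; proj₁; proj₂; map₂; uncurry)
open import Data.Sum using (_⊎_; inj₁; inj₂; [_,_]′) renaming (swap to ⊎-swap)
open import Data.Empty using (⊥-elim)
open import Function using (_∘_; id)
open import Function.Bundles using (mk⇔; Equivalence)
open import Function.Definitions using (Injective)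
open import Relation.Binary.PropositionalEquality
open import Relation.Nullary using (¬_; Dec; yes; no; contradiction)
open import Relation.Nullary.Decidable using (decidable-stable)
open import Relation.Binary using (tri<; tri≈; tri>)

suc[m∸1]≡m : ∀ m .{{_ : NonZero m}} → suc (m ∸ 1) ≡ m
suc[m∸1]≡m (suc m) = refl

[m+kn]/n≡k : ∀ {n} .{{_ : NonZero n}} m k → m < n → (m + k * n) / n ≡ k
[m+kn]/n≡k {n} m k m<n = begin
  (m + k * n) / n     ≡⟨ +-distrib-/-∣ʳ m (divides k refl) ⟩
  m / n + k * n / n   ≡⟨ cong₂ _+_ (m<n⇒m/n≡0 m<n) (m*n/n≡m k n) ⟩
  k                   ∎
  where open ≡-Reasoning

m+kn≡o+ln⇒m%n≡o : ∀ {n} .{{_ : NonZero n}} m o k l → m + k * n ≡ o + l * n → o < n → m % n ≡ o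
m+kn≡o+ln⇒m%n≡o {n} m o k l eq o<n = begin
  m % n             ≡⟨ sym ([m+kn]%n≡m%n m k n) ⟩
  (m + k * n) % n   ≡⟨ cong (_% n) eq ⟩
  (o + l * n) % n   ≡⟨ [m+kn]%n≡m%n o l n ⟩
  o % n             ≡⟨ m<n⇒m%n≡m o<n ⟩
  o                 ∎
  where open ≡-Reasoning

m+cn≤o⇒m/n+c≤o/n : ∀ {n} .{{_ : NonZero n}} m c o → m + c * n ≤ o → m / n + c ≤ o / n
m+cn≤o⇒m/n+c≤o/n {n} m c o le = begin
  m / n + c             ≡⟨ cong (m / n +_) (sym (m*n/n≡m c n)) ⟩
  m / n + c * n / n     ≡⟨ sym (+-distrib-/-∣ʳ m (divides c refl)) ⟩
  (m + c * n) / n       ≤⟨ /-monoˡ-≤ n le ⟩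
  o / n                 ∎
  where open ≤-Reasoning

-- a + b cannot have wrapped past N, so a + b = c.
m+n≡o[mod]⇒m≤o : ∀ {N} .{{_ : NonZero N}} {a b c} α β → a < N → b ≤ c → c < N →
                 a + b + α * N ≡ c + β * N → a ≤ c
m+n≡o[mod]⇒m≤o {N} {a} {b} {c} α β a<N b≤c c<N eq with a + b <? N
... | yes a+b<N = ≤-trans (m≤m+n a b)
                          (≤-reflexive (trans (sym (m<n⇒m%n≡m a+b<N)) (m+kn≡o+ln⇒m%n≡o _ _ α β eq c<N)))
... | no a+b≮N = contradiction a<N (≤⇒≯ N≤a)
  where
  N≤a+b : N ≤ a + b
  N≤a+b = ≮⇒≥ a+b≮N
  x : ℕ
  x = a + b ∸ N
  x+N≡a+b : x + N ≡ a + b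
  x+N≡a+b = m∸n+n≡m N≤a+b
  x<N : x < N
  x<N = +-cancelʳ-< N x N (subst (_< N + N) (sym x+N≡a+b) (+-mono-<-≤ a<N (≤-trans b≤c (<⇒≤ c<N))))
  x≡c : x ≡ c
  x≡c = trans (sym (m<n⇒m%n≡m x<N)) (m+kn≡o+ln⇒m%n≡o x c (suc α) β (begin
    x + (N + α * N)   ≡⟨ sym (+-assoc x N (α * N)) ⟩
    x + N + α * N     ≡⟨ cong (_+ α * N) x+N≡a+b ⟩
    a + b + α * N     ≡⟨ eq ⟩
    c + β * N         ∎) c<N)
    where open ≡-Reasoning
  N≤a : N ≤ a
  N≤a = +-cancelʳ-≤ b N a (begin
    N + b   ≤⟨ +-monoʳ-≤ N b≤c ⟩
    N + c   ≡⟨ +-comm N c ⟩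
    c + N   ≡⟨ cong (_+ N) (sym x≡c) ⟩
    x + N   ≡⟨ x+N≡a+b ⟩
    a + b   ∎)
    where open ≤-Reasoning

m+n≡o[mod]⇒[m≤o⇔n≤o] : ∀ {N} .{{_ : NonZero N}} {a b c} α β → a < N → b < N → c < N →
                        a + b + α * N ≡ c + β * N → a ≤ c ⇔ b ≤ c
m+n≡o[mod]⇒[m≤o⇔n≤o] {N} {a} {b} α β a<N b<N c<N eq =
  mk⇔ (λ a≤c → m+n≡o[mod]⇒m≤o α β b<N a≤c c<N (trans (cong (_+ α * N) (+-comm b a)) eq))
      (λ b≤c → m+n≡o[mod]⇒m≤o α β a<N b≤c c<N eq)

IsCeil : ℕ → ℕ → ℕ → Set
IsCeil x y c = x ≤ c * y × c * y < x + y

ceilDiv-isCeil : ∀ x y .{{_ : NonZero y}} → IsCeil x y (ceilDiv x y)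
ceilDiv-isCeil x y = x≤cy , cy<x+y
  where
  X c : ℕ
  X = x + y ∸ 1
  c = X / y
  X≡x+y∸1 : X ≡ x + (y ∸ 1)
  X≡x+y∸1 = +-∸-assoc x (>-nonZero⁻¹ y)
  y∸1<y : y ∸ 1 < y
  y∸1<y = ≤-reflexive (suc[m∸1]≡m y)
  cy<x+y : c * y < x + y
  cy<x+y = begin-strict
    c * y           ≤⟨ m/n*n≤m X y ⟩
    X               ≡⟨ X≡x+y∸1 ⟩
    x + (y ∸ 1)     <⟨ +-monoʳ-< x y∸1<y ⟩
    x + y           ∎
    where open ≤-Reasoning
  x≤cy : x ≤ c * y
  x≤cy = +-cancelʳ-≤ (y ∸ 1) x (c * y) (s≤s⁻¹ (begin-strict
    x + (y ∸ 1)       ≡⟨ sym X≡x+y∸1 ⟩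
    X                 ≡⟨ m≡m%n+[m/n]*n X y ⟩
    X % y + c * y     <⟨ +-monoˡ-< (c * y) (m%n<n X y) ⟩
    y + c * y         ≡⟨ +-comm y (c * y) ⟩
    c * y + y         ≡⟨ cong (c * y +_) (sym (suc[m∸1]≡m y)) ⟩
    c * y + suc (y ∸ 1) ≡⟨ +-suc (c * y) (y ∸ 1) ⟩
    suc (c * y + (y ∸ 1)) ∎))
    where open ≤-Reasoning

isCeil⇒ceilDiv≡ : ∀ x y c .{{_ : NonZero y}} → IsCeil x y c → ceilDiv x y ≡ c
isCeil⇒ceilDiv≡ x y c (x≤cy , cy<x+y) =
  trans (cong (_/ y) (sym (m∸n+n≡m cy≤X))) ([m+kn]/n≡k (X ∸ c * y) c X∸cy<y)
  where
  X : ℕ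
  X = x + y ∸ 1
  X≡x+y∸1 : X ≡ x + (y ∸ 1)
  X≡x+y∸1 = +-∸-assoc x (>-nonZero⁻¹ y)
  x+y≡1+X : x + y ≡ suc X
  x+y≡1+X = trans (cong (x +_) (sym (suc[m∸1]≡m y))) (trans (+-suc x (y ∸ 1)) (cong suc (sym X≡x+y∸1)))
  cy≤X : c * y ≤ X
  cy≤X = s≤s⁻¹ (subst (c * y <_) x+y≡1+X cy<x+y)
  X∸cy<y : X ∸ c * y < y
  X∸cy<y = +-cancelʳ-< (c * y) (X ∸ c * y) y (begin-strict
    X ∸ c * y + c * y   ≡⟨ m∸n+n≡m cy≤X ⟩
    X                   ≡⟨ X≡x+y∸1 ⟩
    x + (y ∸ 1)         ≤⟨ +-monoˡ-≤ (y ∸ 1) x≤cy ⟩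
    c * y + (y ∸ 1)     <⟨ +-monoʳ-< (c * y) (≤-reflexive (suc[m∸1]≡m y)) ⟩
    c * y + y           ≡⟨ +-comm (c * y) y ⟩
    y + c * y           ∎)
    where open ≤-Reasoning

isCeil-ratio : ∀ {a b A B} I c .{{_ : NonZero b}} .{{_ : NonZero B}} → a * B ≡ A * b →
               IsCeil (I * a) b c → IsCeil (I * A) B c
isCeil-ratio {a} {b} {A} {B} I c aB≡Ab (lower , upper) =
  *-cancelʳ-≤ (I * A) (c * B) b (begin
    I * A * b         ≡⟨ *-assoc I A b ⟩
    I * (A * b)       ≡⟨ cong (I *_) (sym aB≡Ab) ⟩
    I * (a * B)       ≡⟨ sym (*-assoc I a B) ⟩
    I * a * B         ≤⟨ *-monoˡ-≤ B lower ⟩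
    c * b * B         ≡⟨ swap c b B ⟩
    c * B * b         ∎) ,
  *-cancelʳ-< b (c * B) (I * A + B) (begin-strict
    c * B * b             ≡⟨ swap c B b ⟩
    c * b * B             <⟨ *-monoˡ-< B upper ⟩
    (I * a + b) * B       ≡⟨ expand I a b B ⟩
    I * (a * B) + B * b   ≡⟨ cong (λ z → I * z + B * b) aB≡Ab ⟩
    I * (A * b) + B * b   ≡⟨ collect I A b B ⟩
    (I * A + B) * b       ∎)
  where
  open ≤-Reasoning
  swap : ∀ x y z → x * y * z ≡ x * z * y
  swap = solve-∀
  expand : ∀ I a b B → (I * a + b) * B ≡ I * (a * B) + B * b
  expand = solve-∀
  collect : ∀ I A b B → I * (A * b) + B * b ≡ (I * A + B) * b
  collect = solve-∀

rk≤n⇒rk′≤n′ : ∀ {n k n′ k′} r .{{_ : NonZero k}} → n * k′ ≡ n′ * k → r * k ≤ n → r * k′ ≤ n′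
rk≤n⇒rk′≤n′ {n} {k} {n′} {k′} r nk′≡n′k rk≤n = *-cancelʳ-≤ (r * k′) n′ k (begin
  r * k′ * k    ≡⟨ swap r k′ k ⟩
  r * k * k′    ≤⟨ *-monoˡ-≤ k′ rk≤n ⟩
  n * k′        ≡⟨ nk′≡n′k ⟩
  n′ * k        ∎)
  where
  open ≤-Reasoning
  swap : ∀ a b c → a * b * c ≡ a * c * b
  swap = solve-∀

coprime∧nk′≡n′k⇒n′∣n : ∀ {n k n′ k′} → Coprime n′ k′ → n * k′ ≡ n′ * k → n′ ∣ n
coprime∧nk′≡n′k⇒n′∣n {n} {k} {n′} {k′} coprime nk′≡n′k =
  coprime-divisor coprime (divides k (trans (*-comm k′ n) (trans nk′≡n′k (*-comm n′ k))))

record InverseMod (K N : ℕ) : Set where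
  field
    u α β : ℕ
    uK+αN≡1+βN : u * K + α * N ≡ 1 + β * N

coprime⇒inverseMod : ∀ {N K} .{{_ : NonZero N}} → Coprime N K → InverseMod K N
coprime⇒inverseMod {N} {K} coprime with coprime-Bézout coprime
... | Bézout.-+ x y 1+xN≡yK = record { u = y ; α = 0 ; β = x ; uK+αN≡1+βN = trans (+-identityʳ (y * K)) (sym 1+xN≡yK) }
... | Bézout.+- x y 1+yK≡xN = record { u = pred N * y ; α = 1 ; β = pred N * x ; uK+αN≡1+βN = begin
  pred N * y * K + 1 * N              ≡⟨ cong (λ z → pred N * y * K + 1 * z) (sym (suc-pred N)) ⟩
  pred N * y * K + 1 * suc (pred N)   ≡⟨ factor (pred N) y K ⟩
  pred N * (1 + y * K) + 1            ≡⟨ cong (λ z → pred N * z + 1) 1+yK≡xN ⟩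
  pred N * (x * N) + 1                ≡⟨ reassoc (pred N) x N ⟩
  1 + pred N * x * N                  ∎ }
  where
  open ≡-Reasoning
  factor : ∀ p y K → p * y * K + 1 * suc p ≡ p * (1 + y * K) + 1
  factor = solve-∀
  reassoc : ∀ p x N → p * (x * N) + 1 ≡ 1 + p * x * N
  reassoc = solve-∀

toℕ-pointMod : ∀ n .{{_ : NonZero n}} m → toℕ (pointMod n m) ≡ (m ∸ 1) % n
toℕ-pointMod n m = toℕ-fromℕ< _

pointMod-congruence : ∀ n .{{_ : NonZero n}} m → 1 ≤ m → m ≡ suc (toℕ (pointMod n m)) + ((m ∸ 1) / n) * n
pointMod-congruence n m 1≤m = begin
  m                                       ≡⟨ sym (m∸n+n≡m 1≤m) ⟩
  m ∸ 1 + 1                               ≡⟨ +-comm (m ∸ 1) 1 ⟩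
  suc (m ∸ 1)                             ≡⟨ cong suc (m≡m%n+[m/n]*n (m ∸ 1) n) ⟩
  suc ((m ∸ 1) % n + (m ∸ 1) / n * n)     ≡⟨ cong (λ r → suc (r + (m ∸ 1) / n * n)) (sym (toℕ-pointMod n m)) ⟩
  suc (toℕ (pointMod n m)) + (m ∸ 1) / n * n ∎
  where open ≡-Reasoning

pointMod-≡ : ∀ {n} .{{_ : NonZero n}} {m t} k l → 1 ≤ m → t < n → m + k * n ≡ suc t + l * n →
             toℕ (pointMod n m) ≡ t
pointMod-≡ {n} {m} {t} k l 1≤m t<n eq =
  trans (toℕ-pointMod n m) (m+kn≡o+ln⇒m%n≡o (m ∸ 1) t k l (suc-injective (begin
    suc (m ∸ 1 + k * n)   ≡⟨ cong (_+ k * n) (trans (+-comm 1 (m ∸ 1)) (m∸n+n≡m 1≤m)) ⟩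
    m + k * n             ≡⟨ eq ⟩
    suc t + l * n         ∎)) t<n)
  where open ≡-Reasoning

image : ∀ {n k} → (Fin k → Fin n) → Subset n
image {k = zero}  f = ∅
image {k = suc k} f = ⁅ f fzero ⁆ ∪ image (f ∘ fsuc)

⋃-singletons≡image : ∀ {n k} (f : Fin k → Fin n) → ⋃ (map (λ i → ⁅ f i ⁆) (allFin k)) ≡ image f
⋃-singletons≡image {k = zero}  f = refl
⋃-singletons≡image {k = suc k} f =
  cong (⁅ f fzero ⁆ ∪_) (trans (cong ⋃ reindex) (⋃-singletons≡image (f ∘ fsuc)))
  where
  reindex : map (λ i → ⁅ f i ⁆) (tabulate {n = k} fsuc) ≡ map (λ i → ⁅ f (fsuc i) ⁆) (allFin k)
  reindex = trans (map-tabulate fsuc _) (sym (map-tabulate id _))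

∈image⇒ : ∀ {n k} (f : Fin k → Fin n) {x} → x ∈ image f → ∃ λ i → f i ≡ x
∈image⇒ {k = zero}  f x∈ = ⊥-elim (∉⊥ x∈)
∈image⇒ {k = suc k} f x∈ with x∈p∪q⁻ _ _ x∈
... | inj₁ x∈⁅f0⁆ = fzero , sym (x∈⁅y⁆⇒x≡y _ x∈⁅f0⁆)
... | inj₂ x∈rest with ∈image⇒ (f ∘ fsuc) x∈rest
...   | i , fi≡x = fsuc i , fi≡x

∈image : ∀ {n k} (f : Fin k → Fin n) i → f i ∈ image f
∈image f fzero    = x∈p∪q⁺ (inj₁ (x∈⁅x⁆ _))
∈image f (fsuc i) = x∈p∪q⁺ (inj₂ (∈image (f ∘ fsuc) i))

∣⁅x⁆∪p∣≡1+∣p∣ : ∀ {n} (x : Fin n) (p : Subset n) → x ∉ p → ∣ ⁅ x ⁆ ∪ p ∣ ≡ suc ∣ p ∣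
∣⁅x⁆∪p∣≡1+∣p∣ fzero    (false ∷ p) x∉p = cong (suc ∘ ∣_∣) (∪-identityˡ p)
∣⁅x⁆∪p∣≡1+∣p∣ fzero    (true ∷ p)  x∉p = ⊥-elim (x∉p here)
∣⁅x⁆∪p∣≡1+∣p∣ (fsuc x) (false ∷ p) x∉p = ∣⁅x⁆∪p∣≡1+∣p∣ x p (x∉p ∘ there)
∣⁅x⁆∪p∣≡1+∣p∣ (fsuc x) (true ∷ p)  x∉p = cong suc (∣⁅x⁆∪p∣≡1+∣p∣ x p (x∉p ∘ there))

∣image∣≡k : ∀ {n k} (f : Fin k → Fin n) → Injective _≡_ _≡_ f → ∣ image f ∣ ≡ k
∣image∣≡k {n} {zero}  f f-inj = ∣⊥∣≡0 n
∣image∣≡k {k = suc k} f f-inj =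
  trans (∣⁅x⁆∪p∣≡1+∣p∣ (f fzero) _ f0∉rest) (cong suc (∣image∣≡k (f ∘ fsuc) (fsuc-injective ∘ f-inj)))
  where
  f0∉rest : f fzero ∉ image (f ∘ fsuc)
  f0∉rest f0∈ with ∈image⇒ (f ∘ fsuc) f0∈
  ... | i , fi≡f0 with f-inj fi≡f0
  ... | ()

StrictlyIncreasing : ∀ {n k} → (Fin k → Fin n) → Set
StrictlyIncreasing f = ∀ i j → i <ᶠ j → f i <ᶠ f j

module _ {n k} {f : Fin k → Fin n} (f-inc : StrictlyIncreasing f) where

  increasing-mono : ∀ i j → toℕ i ≤ toℕ j → toℕ (f i) ≤ toℕ (f j)
  increasing-mono i j i≤j with m≤n⇒m<n∨m≡n i≤j
  ... | inj₁ i<j = <⇒≤ (f-inc i j i<j)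
  ... | inj₂ i≡j = ≤-reflexive (cong (toℕ ∘ f) (toℕ-injective i≡j))

  increasing-injective : Injective _≡_ _≡_ f
  increasing-injective {i} {j} fi≡fj with <-cmp (toℕ i) (toℕ j)
  ... | tri< i<j _ _ = contradiction (cong toℕ fi≡fj) (<⇒≢ (f-inc i j i<j))
  ... | tri≈ _ i≡j _ = toℕ-injective i≡j
  ... | tri> _ _ j<i = contradiction (cong toℕ (sym fi≡fj)) (<⇒≢ (f-inc j i j<i))

  image-enumerates : Enumerates (image f) f
  image-enumerates = f-inc , λ x → mk⇔ (∈image⇒ f) λ { (i , refl) → ∈image f i }

-- A common point p i = q j contradicts p i < q i ≤ q j when i ≤ j, and q j < p (j + 1) ≤ p i when j < i.
alternates⇒disjoint : ∀ {n k} {P Q : Subset n} → Alternates {n} {k} P Q → ∀ {x} → x ∈ P → x ∉ Q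
alternates⇒disjoint {k = k} (p , q , (p-inc , p-enum) , (q-inc , q-enum) , p<q , q<p) {x} x∈P x∈Q
  with Equivalence.to (p-enum x) x∈P | Equivalence.to (q-enum x) x∈Q
... | i , pi≡x | j , qj≡x with toℕ i ≤? toℕ j
...   | yes i≤j = <-irrefl pi≡qj (≤-<-trans (increasing-mono p-inc i j i≤j) (p<q j))
  where
  pi≡qj : toℕ (p i) ≡ toℕ (q j)
  pi≡qj = cong toℕ (trans pi≡x (sym qj≡x))
...   | no i≰j = <-irrefl (cong toℕ (trans qj≡x (sym pi≡x)))
                          (<-≤-trans (q<p j j′ (toℕ-fromℕ< 1+j<k)) (increasing-mono p-inc j′ i j′≤i))
  where
  1+j≤i : suc (toℕ j) ≤ toℕ i
  1+j≤i = ≰⇒> i≰j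
  1+j<k : suc (toℕ j) < k
  1+j<k = ≤-<-trans 1+j≤i (toℕ<n i)
  j′ : Fin k
  j′ = fromℕ< 1+j<k
  j′≤i : toℕ j′ ≤ toℕ i
  j′≤i = subst (_≤ toℕ i) (sym (toℕ-fromℕ< 1+j<k)) 1+j≤i

cdist-sym : ∀ {n} (x y : Fin n) → cdist x y ≡ cdist y x
cdist-sym {n} x y = cong (λ d → d ⊓ (n ∸ d)) (∣-∣-comm (toℕ x) (toℕ y))

≤cdist⇔ : ∀ {n} (x y : Fin n) r → toℕ x ≤ toℕ y →
          r ≤ cdist x y ⇔ (toℕ x + r ≤ toℕ y × toℕ y + r ≤ toℕ x + n)
≤cdist⇔ {n} x y r X≤Y = mk⇔ to from
  where
  X Y d : ℕ
  X = toℕ x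
  Y = toℕ y
  d = Y ∸ X
  cdist≡ : cdist x y ≡ d ⊓ (n ∸ d)
  cdist≡ = cong (λ e → e ⊓ (n ∸ e)) (m≤n⇒∣m-n∣≡n∸m X≤Y)
  d≤n : d ≤ n
  d≤n = ≤-trans (m∸n≤m Y X) (<⇒≤ (toℕ<n y))
  Y+r≡X+[r+d] : Y + r ≡ X + (r + d)
  Y+r≡X+[r+d] = begin
    Y + r         ≡⟨ cong (_+ r) (sym (m+[n∸m]≡n X≤Y)) ⟩
    X + d + r     ≡⟨ +-assoc X d r ⟩
    X + (d + r)   ≡⟨ cong (X +_) (+-comm d r) ⟩
    X + (r + d)   ∎
    where open ≡-Reasoning
  to : r ≤ cdist x y → X + r ≤ Y × Y + r ≤ X + n
  to r≤ = subst (_≤ Y) (+-comm r X) (m≤o∸n⇒m+n≤o r X≤Y (m≤n⊓o⇒m≤n d (n ∸ d) r≤′)) ,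
          subst (_≤ X + n) (sym Y+r≡X+[r+d]) (+-monoʳ-≤ X (m≤o∸n⇒m+n≤o r d≤n (m≤n⊓o⇒m≤o d (n ∸ d) r≤′)))
    where
    r≤′ : r ≤ d ⊓ (n ∸ d)
    r≤′ = subst (r ≤_) cdist≡ r≤
  from : X + r ≤ Y × Y + r ≤ X + n → r ≤ cdist x y
  from (X+r≤Y , Y+r≤X+n) = subst (r ≤_) (sym cdist≡) (⊓-glb
    (m+n≤o⇒m≤o∸n r (subst (_≤ Y) (+-comm X r) X+r≤Y))
    (m+n≤o⇒m≤o∸n r (+-cancelˡ-≤ X (r + d) n (subst (_≤ X + n) Y+r≡X+[r+d] Y+r≤X+n))))

module EquiPolygons (n k N K : ℕ) .{{_ : NonZero n}} .{{_ : NonZero k}} .{{_ : NonZero N}} .{{_ : NonZero K}}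
                    (nK≡Nk : n * K ≡ N * k) (K≤N : K ≤ N) where

  kN≡nK : k * N ≡ n * K
  kN≡nK = trans (*-comm k N) (sym nK≡Nk)

  pred[K]<N : pred K < N
  pred[K]<N = subst (_≤ N) (sym (suc-pred K)) K≤N

  vertex : ℕ → ℕ → ℕ
  vertex D m = (D + m * N) / K

  vertex<n : ∀ {D m} → D < N → m < k → vertex D m < n
  vertex<n {D} {m} D<N m<k = m<n*o⇒m/o<n (begin-strict
    D + m * N   <⟨ +-monoˡ-< (m * N) D<N ⟩
    suc m * N   ≤⟨ *-monoˡ-≤ N m<k ⟩
    k * N       ≡⟨ kN≡nK ⟩
    n * K       ∎)
    where open ≤-Reasoning

  -- t = vertex D m for some m < k iff D − t K is below K modulo N; since n K ≡ 0 (mod N), the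
  -- term (n − t) K stands for − t K without truncated subtraction.
  residue : ℕ → ℕ → ℕ
  residue D t = (D + (n ∸ t) * K) % N

  IsVertex : ℕ → ℕ → Set
  IsVertex D t = residue D t < K

  D+[n∸t]K+tK≡D+nK : ∀ D t → t ≤ n → D + (n ∸ t) * K + t * K ≡ D + n * K
  D+[n∸t]K+tK≡D+nK D t t≤n = begin
    D + (n ∸ t) * K + t * K     ≡⟨ +-assoc D _ _ ⟩
    D + ((n ∸ t) * K + t * K)   ≡⟨ cong (D +_) (sym (*-distribʳ-+ K (n ∸ t) t)) ⟩
    D + (n ∸ t + t) * K         ≡⟨ cong (λ z → D + z * K) (m∸n+n≡m t≤n) ⟩
    D + n * K                   ∎
    where open ≡-Reasoning

  vertex-isVertex : ∀ {D m} → D < N → m < k → IsVertex D (vertex D m)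
  vertex-isVertex {D} {m} D<N m<k = subst (_< K) (sym Y%N≡ρ) (m%n<n X K)
    where
    X t ρ Y : ℕ
    X = D + m * N
    t = vertex D m
    ρ = X % K
    Y = D + (n ∸ t) * K
    Y+tK≡ρ+[k∸m]N+tK : Y + t * K ≡ ρ + (k ∸ m) * N + t * K
    Y+tK≡ρ+[k∸m]N+tK = begin
      Y + t * K                   ≡⟨ D+[n∸t]K+tK≡D+nK D t (<⇒≤ (vertex<n D<N m<k)) ⟩
      D + n * K                   ≡⟨ cong (D +_) (sym kN≡nK) ⟩
      D + k * N                   ≡⟨ cong (λ z → D + z * N) (sym (m+[n∸m]≡n (<⇒≤ m<k))) ⟩
      D + (m + (k ∸ m)) * N       ≡⟨ split D m (k ∸ m) N ⟩
      X + (k ∸ m) * N             ≡⟨ cong (_+ (k ∸ m) * N) (m≡m%n+[m/n]*n X K) ⟩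
      ρ + t * K + (k ∸ m) * N     ≡⟨ swap ρ (t * K) ((k ∸ m) * N) ⟩
      ρ + (k ∸ m) * N + t * K     ∎
      where
      open ≡-Reasoning
      split : ∀ D m q N → D + (m + q) * N ≡ D + m * N + q * N
      split = solve-∀
      swap : ∀ a b c → a + b + c ≡ a + c + b
      swap = solve-∀
    Y%N≡ρ : Y % N ≡ ρ
    Y%N≡ρ = m+kn≡o+ln⇒m%n≡o Y ρ 0 (k ∸ m)
              (trans (+-identityʳ Y) (+-cancelʳ-≡ (t * K) Y _ Y+tK≡ρ+[k∸m]N+tK))
              (<-≤-trans (m%n<n X K) K≤N)

  isVertex⇒vertex : ∀ {D t} → D < N → t < n → IsVertex D t → ∃ λ m → m < k × vertex D m ≡ t
  isVertex⇒vertex {D} {t} D<N t<n Y%N<K = k ∸ q , k∸q<k , vertex≡t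
    where
    Y ρ q : ℕ
    Y = D + (n ∸ t) * K
    ρ = Y % N
    q = Y / N
    Y≡ρ+qN : Y ≡ ρ + q * N
    Y≡ρ+qN = m≡m%n+[m/n]*n Y N
    q≢0 : q ≢ 0
    q≢0 q≡0 = <⇒≱ Y%N<K (begin
      K           ≡⟨ sym (*-identityˡ K) ⟩
      1 * K       ≤⟨ *-monoˡ-≤ K (m<n⇒0<n∸m t<n) ⟩
      (n ∸ t) * K ≤⟨ m≤n+m _ D ⟩
      Y           ≡⟨ Y≡ρ+qN ⟩
      ρ + q * N   ≡⟨ cong (λ z → ρ + z * N) q≡0 ⟩
      ρ + 0       ≡⟨ +-identityʳ ρ ⟩
      ρ           ∎)
      where open ≤-Reasoning
    q≤k : q ≤ k
    q≤k = s≤s⁻¹ (m<n*o⇒m/o<n (begin-strict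
      Y           ≤⟨ +-monoʳ-≤ D (*-monoˡ-≤ K (m∸n≤m n t)) ⟩
      D + n * K   <⟨ +-monoˡ-< (n * K) D<N ⟩
      N + n * K   ≡⟨ cong (N +_) (sym kN≡nK) ⟩
      suc k * N   ∎))
      where open ≤-Reasoning
    k∸q<k : k ∸ q < k
    k∸q<k = ∸-monoʳ-< (n≢0⇒n>0 q≢0) q≤k
    D+[k∸q]N≡ρ+tK : D + (k ∸ q) * N ≡ ρ + t * K
    D+[k∸q]N≡ρ+tK = +-cancelʳ-≡ (q * N) _ _ (begin
      D + (k ∸ q) * N + q * N   ≡⟨ collect D (k ∸ q) q N ⟩
      D + (k ∸ q + q) * N       ≡⟨ cong (λ z → D + z * N) (m∸n+n≡m q≤k) ⟩
      D + k * N                 ≡⟨ cong (D +_) kN≡nK ⟩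
      D + n * K                 ≡⟨ sym (D+[n∸t]K+tK≡D+nK D t (<⇒≤ t<n)) ⟩
      Y + t * K                 ≡⟨ cong (_+ t * K) Y≡ρ+qN ⟩
      ρ + q * N + t * K         ≡⟨ swap ρ (q * N) (t * K) ⟩
      ρ + t * K + q * N         ∎)
      where
      open ≡-Reasoning
      collect : ∀ D m q N → D + m * N + q * N ≡ D + (m + q) * N
      collect = solve-∀
      swap : ∀ a b c → a + b + c ≡ a + c + b
      swap = solve-∀
    vertex≡t : vertex D (k ∸ q) ≡ t
    vertex≡t = trans (cong (_/ K) D+[k∸q]N≡ρ+tK) ([m+kn]/n≡k ρ t Y%N<K)

  vertexFin : Fin N → Fin k → Fin n
  vertexFin a m = fromℕ< (vertex<n (toℕ<n a) (toℕ<n m))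

  toℕ-vertexFin : ∀ a m → toℕ (vertexFin a m) ≡ vertex (toℕ a) (toℕ m)
  toℕ-vertexFin a m = toℕ-fromℕ< _

  polygon : Fin N → Subset n
  polygon a = image (vertexFin a)

  ∈polygon⇒isVertex : ∀ a {x} → x ∈ polygon a → IsVertex (toℕ a) (toℕ x)
  ∈polygon⇒isVertex a x∈ with ∈image⇒ (vertexFin a) x∈
  ... | m , refl = subst (IsVertex (toℕ a)) (sym (toℕ-vertexFin a m)) (vertex-isVertex (toℕ<n a) (toℕ<n m))

  isVertex⇒∈polygon : ∀ a x → IsVertex (toℕ a) (toℕ x) → x ∈ polygon a
  isVertex⇒∈polygon a x isV with isVertex⇒vertex (toℕ<n a) (toℕ<n x) isV
  ... | m , m<k , vertex≡x = subst (_∈ polygon a) vertexFin≡x (∈image (vertexFin a) (fromℕ< m<k))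
    where
    vertexFin≡x : vertexFin a (fromℕ< m<k) ≡ x
    vertexFin≡x = toℕ-injective (trans (toℕ-vertexFin a (fromℕ< m<k)) (trans (cong (vertex (toℕ a)) (toℕ-fromℕ< m<k)) vertex≡x))

  vertex+c≤vertex : ∀ D {m m′} c → c * K ≤ N → m < m′ → vertex D m + c ≤ vertex D m′
  vertex+c≤vertex D {m} {m′} c cK≤N m<m′ = m+cn≤o⇒m/n+c≤o/n (D + m * N) c (D + m′ * N) (begin
    D + m * N + c * K   ≤⟨ +-monoʳ-≤ (D + m * N) cK≤N ⟩
    D + m * N + N       ≡⟨ +-assoc D (m * N) N ⟩
    D + (m * N + N)     ≡⟨ cong (D +_) (+-comm (m * N) N) ⟩
    D + suc m * N       ≤⟨ +-monoʳ-≤ D (*-monoˡ-≤ N m<m′) ⟩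
    D + m′ * N          ∎)
    where open ≤-Reasoning

  vertex+r≤vertex+n : ∀ D m {m′} r → r * K ≤ N → m′ < k → vertex D m′ + r ≤ vertex D m + n
  vertex+r≤vertex+n D m {m′} r rK≤N m′<k = begin
    vertex D m′ + r                 ≤⟨ m+cn≤o⇒m/n+c≤o/n (D + m′ * N) r (D + m * N + n * K) (begin
        D + m′ * N + r * K          ≤⟨ +-monoʳ-≤ (D + m′ * N) rK≤N ⟩
        D + m′ * N + N              ≡⟨ +-assoc D (m′ * N) N ⟩
        D + (m′ * N + N)            ≡⟨ cong (D +_) (+-comm (m′ * N) N) ⟩
        D + suc m′ * N              ≤⟨ +-monoʳ-≤ D (*-monoˡ-≤ N m′<k) ⟩
        D + k * N                   ≤⟨ +-monoʳ-≤ D (m≤n+m (k * N) (m * N)) ⟩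
        D + (m * N + k * N)         ≡⟨ sym (+-assoc D (m * N) (k * N)) ⟩
        D + m * N + k * N           ≡⟨ cong (D + m * N +_) kN≡nK ⟩
        D + m * N + n * K           ∎) ⟩
    (D + m * N + n * K) / K         ≡⟨ +-distrib-/-∣ʳ (D + m * N) (divides n refl) ⟩
    vertex D m + n * K / K          ≡⟨ cong (vertex D m +_) (m*n/n≡m n K) ⟩
    vertex D m + n                  ∎
    where open ≤-Reasoning

  vertexFin-increasing : ∀ a → StrictlyIncreasing (vertexFin a)
  vertexFin-increasing a i j i<j =
    subst₂ (λ x y → suc x ≤ y) (sym (toℕ-vertexFin a i)) (sym (toℕ-vertexFin a j))
           (subst (_≤ vertex (toℕ a) (toℕ j)) (+-comm (vertex (toℕ a) (toℕ i)) 1) (vertex+c≤vertex (toℕ a) 1 (≤-trans (≤-reflexive (*-identityˡ K)) K≤N) i<j))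

  ∣polygon∣≡k : ∀ a → ∣ polygon a ∣ ≡ k
  ∣polygon∣≡k a = ∣image∣≡k (vertexFin a) (increasing-injective (vertexFin-increasing a))

  vertices-separated : ∀ {r} → r * K ≤ N → ∀ a i j → toℕ i < toℕ j → r ≤ cdist (vertexFin a i) (vertexFin a j)
  vertices-separated {r} rK≤N a i j i<j =
    Equivalence.from (≤cdist⇔ (vertexFin a i) (vertexFin a j) r (<⇒≤ (vertexFin-increasing a i j i<j)))
      (subst₂ (λ u v → u + r ≤ v) (sym (toℕ-vertexFin a i)) (sym (toℕ-vertexFin a j))
          (vertex+c≤vertex (toℕ a) r rK≤N i<j) ,
       subst₂ (λ u v → u + r ≤ v + n) (sym (toℕ-vertexFin a j)) (sym (toℕ-vertexFin a i))
          (vertex+r≤vertex+n (toℕ a) (toℕ i) r rK≤N (toℕ<n j)))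

  polygon-stable : ∀ {r} → r * K ≤ N → ∀ a → Stable r (polygon a)
  polygon-stable {r} rK≤N a x y x∈ y∈ x≢y with ∈image⇒ (vertexFin a) x∈ | ∈image⇒ (vertexFin a) y∈
  ... | m , refl | m′ , refl with <-cmp (toℕ m) (toℕ m′)
  ... | tri< m<m′ _ _ = vertices-separated rK≤N a m m′ m<m′
  ... | tri≈ _ m≡m′ _ = contradiction (cong (vertexFin a) (toℕ-injective m≡m′)) x≢y
  ... | tri> _ _ m′<m = subst (r ≤_) (cdist-sym (vertexFin a m′) (vertexFin a m)) (vertices-separated rK≤N a m′ m m′<m)

  phase : ℕ → ℕ
  phase j = (j * K + pred N) % N

  phaseFin : Fin n → Fin N
  phaseFin j = fromℕ< (m%n<n (toℕ j * K + pred N) N)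

  toℕ-phaseFin : ∀ j → toℕ (phaseFin j) ≡ phase (toℕ j)
  toℕ-phaseFin j = toℕ-fromℕ< _

  -- If t ≡ j + c − 1 (mod n), then D − t K + c K ≡ K − 1 (mod N) for D = phase j, since n K ≡ 0.
  phase+[n∸t]K+cK≡pred[K] : ∀ j t c Q₁ Q₂ → t ≤ n → j + c + Q₁ * n ≡ suc t + Q₂ * n →
    phase j + (n ∸ t) * K + c * K + ((j * K + pred N) / N + Q₁ * k) * N ≡ pred K + (1 + (1 + Q₂) * k) * N
  phase+[n∸t]K+cK≡pred[K] j t c Q₁ Q₂ t≤n eq = begin
    D + s * K + c * K + (p + Q₁ * k) * N          ≡⟨ regroup D s K c p Q₁ k N ⟩
    (D + p * N) + s * K + c * K + Q₁ * (k * N)    ≡⟨ cong₂ (λ x y → x + s * K + c * K + Q₁ * y)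
                                                           (sym (m≡m%n+[m/n]*n (j * K + pred N) N)) kN≡nK ⟩
    j * K + pred N + s * K + c * K + Q₁ * (n * K) ≡⟨ factor j K (pred N) s c Q₁ n ⟩
    (j + c + Q₁ * n) * K + s * K + pred N         ≡⟨ cong (λ x → x * K + s * K + pred N) eq ⟩
    (suc t + Q₂ * n) * K + s * K + pred N         ≡⟨ expand t Q₂ n K s (pred N) ⟩
    (s + t) * K + Q₂ * (n * K) + K + pred N       ≡⟨ cong₂ (λ x y → x * K + Q₂ * (n * K) + y + pred N)
                                                           (m∸n+n≡m t≤n) (sym (suc-pred K)) ⟩
    n * K + Q₂ * (n * K) + suc (pred K) + pred N  ≡⟨ shuffle n K Q₂ (pred K) (pred N) ⟩
    pred K + suc (pred N) + (1 + Q₂) * (n * K)    ≡⟨ cong₂ (λ x y → pred K + x + (1 + Q₂) * y) (suc-pred N) (sym kN≡nK) ⟩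
    pred K + N + (1 + Q₂) * (k * N)               ≡⟨ collect (pred K) N Q₂ k ⟩
    pred K + (1 + (1 + Q₂) * k) * N               ∎
    where
    open ≡-Reasoning
    D s p : ℕ
    D = phase j
    s = n ∸ t
    p = (j * K + pred N) / N
    regroup : ∀ D s K c p Q₁ k N → D + s * K + c * K + (p + Q₁ * k) * N ≡ (D + p * N) + s * K + c * K + Q₁ * (k * N)
    regroup = solve-∀
    factor : ∀ j K e s c Q₁ n → j * K + e + s * K + c * K + Q₁ * (n * K) ≡ (j + c + Q₁ * n) * K + s * K + e
    factor = solve-∀
    expand : ∀ t Q₂ n K s e → (suc t + Q₂ * n) * K + s * K + e ≡ (s + t) * K + Q₂ * (n * K) + K + e
    expand = solve-∀
    shuffle : ∀ n K Q₂ K₁ e → n * K + Q₂ * (n * K) + suc K₁ + e ≡ K₁ + suc e + (1 + Q₂) * (n * K)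
    shuffle = solve-∀
    collect : ∀ K₁ N Q₂ k → K₁ + N + (1 + Q₂) * (k * N) ≡ K₁ + (1 + (1 + Q₂) * k) * N
    collect = solve-∀

  isVertex⇔residue<K : ∀ j t c Q₁ Q₂ → t ≤ n → j + c + Q₁ * n ≡ suc t + Q₂ * n →
                       IsVertex (phase j) t ⇔ (c * K) % N < K
  isVertex⇔residue<K j t c Q₁ Q₂ t≤n eq =
    mk⇔ (λ a<K → m≤pred[n]⇒suc[m]≤n (Equivalence.to residues (suc[m]≤n⇒m≤pred[n] a<K)))
        (λ b<K → m≤pred[n]⇒suc[m]≤n (Equivalence.from residues (suc[m]≤n⇒m≤pred[n] b<K)))
    where
    A α : ℕ
    A = phase j + (n ∸ t) * K
    α = A / N + (c * K) / N + ((j * K + pred N) / N + Q₁ * k)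
    residues : A % N ≤ pred K ⇔ (c * K) % N ≤ pred K
    residues = m+n≡o[mod]⇒[m≤o⇔n≤o] α (1 + (1 + Q₂) * k) (m%n<n A N) (m%n<n (c * K) N) pred[K]<N (begin
      A % N + (c * K) % N + α * N           ≡⟨ regroup (A % N) (A / N) ((c * K) % N) ((c * K) / N) _ N ⟩
      (A % N + A / N * N) + ((c * K) % N + (c * K) / N * N) + ((j * K + pred N) / N + Q₁ * k) * N
                                            ≡⟨ cong₂ (λ x y → x + y + ((j * K + pred N) / N + Q₁ * k) * N)
                                                     (sym (m≡m%n+[m/n]*n A N)) (sym (m≡m%n+[m/n]*n (c * K) N)) ⟩
      A + c * K + ((j * K + pred N) / N + Q₁ * k) * N
                                            ≡⟨ phase+[n∸t]K+cK≡pred[K] j t c Q₁ Q₂ t≤n eq ⟩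
      pred K + (1 + (1 + Q₂) * k) * N       ∎)
      where
      open ≡-Reasoning
      regroup : ∀ a q b q′ x N → a + b + (q + q′ + x) * N ≡ (a + q * N) + (b + q′ * N) + x * N
      regroup = solve-∀

  offset-residue<K : ∀ i → (offset n k i * K) % N < K
  offset-residue<K fzero = subst (_< K) (sym (trans (cong (_% N) (sym kN≡nK)) (m*n%n≡0 k N))) (>-nonZero⁻¹ K)
  offset-residue<K (fsuc i) = subst (_< K) (sym cK%N≡ρ) ρ<K
    where
    c I : ℕ
    c = offset n k (fsuc i)
    I = suc (toℕ i)
    window : IsCeil (I * N) K c
    window = isCeil-ratio I c nK≡Nk (ceilDiv-isCeil (I * n) k)
    IN≤cK : I * N ≤ c * K
    IN≤cK = proj₁ window
    ρ : ℕ
    ρ = c * K ∸ I * N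
    ρ<K : ρ < K
    ρ<K = +-cancelʳ-< (I * N) ρ K (subst (_< K + I * N) (sym (m∸n+n≡m IN≤cK))
                                        (subst (c * K <_) (+-comm (I * N) K) (proj₂ window)))
    cK%N≡ρ : (c * K) % N ≡ ρ
    cK%N≡ρ = m+kn≡o+ln⇒m%n≡o (c * K) ρ 0 I (trans (+-identityʳ (c * K)) (sym (m∸n+n≡m IN≤cK))) (<-≤-trans ρ<K K≤N)

  1≤offset : ∀ i → 1 ≤ offset n k i
  1≤offset fzero = >-nonZero⁻¹ n
  1≤offset (fsuc i) with offset n k (fsuc i) | proj₁ (ceilDiv-isCeil (suc (toℕ i) * n) k)
  ... | zero  | n+in≤0 = contradiction (≤-trans (m≤m+n n _) n+in≤0) (<⇒≱ (>-nonZero⁻¹ n))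
  ... | suc _ | _      = s≤s z≤n

  offset≡n : ∃ λ i → offset n k i ≡ n
  offset≡n = first (fromℕ< (>-nonZero⁻¹ k))
    where
    first : Fin k → ∃ λ i → offset n k i ≡ n
    first fzero    = fzero , refl
    first (fsuc _) = fzero , refl

  -- Conversely every c ∈ [1, n] with c K mod N < K is an offset: writing c K = ρ + q N,
  -- c = n when q = k, and c = ⌈ q n / k ⌉ otherwise.
  offset-surjective : ∀ c → 1 ≤ c → c ≤ n → (c * K) % N < K → ∃ λ i → offset n k i ≡ c
  offset-surjective c 1≤c c≤n ρ<K = from-quotient (m≤n⇒m<n∨m≡n q≤k)
    where
    ρ q : ℕ
    ρ = (c * K) % N
    q = (c * K) / N
    cK≡ρ+qN : c * K ≡ ρ + q * N
    cK≡ρ+qN = m≡m%n+[m/n]*n (c * K) N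
    q≤k : q ≤ k
    q≤k = begin
      q           ≤⟨ /-monoˡ-≤ N (*-monoˡ-≤ K c≤n) ⟩
      n * K / N   ≡⟨ cong (_/ N) (sym kN≡nK) ⟩
      k * N / N   ≡⟨ m*n/n≡m k N ⟩
      k           ∎
      where open ≤-Reasoning
    q≢0 : q ≢ 0
    q≢0 q≡0 = <⇒≱ ρ<K (begin
      K           ≡⟨ sym (*-identityˡ K) ⟩
      1 * K       ≤⟨ *-monoˡ-≤ K 1≤c ⟩
      c * K       ≡⟨ cK≡ρ+qN ⟩
      ρ + q * N   ≡⟨ cong (λ x → ρ + x * N) q≡0 ⟩
      ρ + 0       ≡⟨ +-identityʳ ρ ⟩
      ρ           ∎)
      where open ≤-Reasoning
    qN-window : IsCeil (q * N) K c
    qN-window = ≤-trans (m≤n+m (q * N) ρ) (≤-reflexive (sym cK≡ρ+qN)) ,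
                subst (_< q * N + K) (sym cK≡ρ+qN) (subst (ρ + q * N <_) (+-comm K (q * N)) (+-monoˡ-< (q * N) ρ<K))
    from-index : (i : Fin k) → toℕ i ≡ q → ∃ λ i → offset n k i ≡ c
    from-index fzero     0≡q   = contradiction (sym 0≡q) q≢0
    from-index (fsuc i₀) 1+i≡q = fsuc i₀ ,
      trans (cong (λ I → ceilDiv (I * n) k) 1+i≡q) (isCeil⇒ceilDiv≡ (q * n) k c (isCeil-ratio q c (sym nK≡Nk) qN-window))
    from-quotient : q < k ⊎ q ≡ k → ∃ λ i → offset n k i ≡ c
    from-quotient (inj₁ q<k) = from-index (fromℕ< q<k) (toℕ-fromℕ< q<k)
    from-quotient (inj₂ q≡k) = map₂ (λ off≡n → trans off≡n (sym c≡n)) offset≡n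
      where
      c≡n : c ≡ n
      c≡n = ≤-antisym c≤n (*-cancelʳ-≤ n c K (begin
        n * K       ≡⟨ sym kN≡nK ⟩
        k * N       ≡⟨ cong (_* N) (sym q≡k) ⟩
        q * N       ≤⟨ m≤n+m (q * N) ρ ⟩
        ρ + q * N   ≡⟨ sym cK≡ρ+qN ⟩
        c * K       ∎))
        where open ≤-Reasoning

  pequiPoint-isVertex : ∀ (j : Fin n) i → IsVertex (phase (toℕ j)) (toℕ (pointMod n (toℕ j + offset n k i)))
  pequiPoint-isVertex j i =
    Equivalence.from (isVertex⇔residue<K (toℕ j) t c 0 ((m ∸ 1) / n) (<⇒≤ (toℕ<n (pointMod n m))) congruence)
                     (offset-residue<K i)
    where
    c m t : ℕ
    c = offset n k i
    m = toℕ j + c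
    t = toℕ (pointMod n m)
    congruence : m + 0 * n ≡ suc t + (m ∸ 1) / n * n
    congruence = trans (+-identityʳ m) (pointMod-congruence n m (≤-trans (1≤offset i) (m≤n+m c (toℕ j))))

  isVertex⇒pequiPoint : ∀ (j x : Fin n) → IsVertex (phase (toℕ j)) (toℕ x) → ∃ λ i → pointMod n (toℕ j + offset n k i) ≡ x
  isVertex⇒pequiPoint j x isV =
    from-offset (offset-surjective c (s≤s z≤n) (m%n<n V n) (Equivalence.to (isVertex⇔residue<K jₙ t c Q 1 (<⇒≤ t<n) congruence) isV))
    where
    jₙ t : ℕ
    jₙ = toℕ j
    t = toℕ x
    t<n : t < n
    t<n = toℕ<n x
    V c Q : ℕ
    V = t + (n ∸ jₙ)
    c = suc (V % n)
    Q = V / n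
    congruence : jₙ + c + Q * n ≡ suc t + 1 * n
    congruence = begin
      jₙ + suc (V % n) + Q * n    ≡⟨ regroup jₙ (V % n) (Q * n) ⟩
      suc (jₙ + (V % n + Q * n))  ≡⟨ cong (λ z → suc (jₙ + z)) (sym (m≡m%n+[m/n]*n V n)) ⟩
      suc (jₙ + (t + (n ∸ jₙ)))   ≡⟨ cong suc (swap jₙ t (n ∸ jₙ)) ⟩
      suc (t + (jₙ + (n ∸ jₙ)))   ≡⟨ cong (λ z → suc (t + z)) (m+[n∸m]≡n (<⇒≤ (toℕ<n j))) ⟩
      suc t + n                   ≡⟨ cong (suc t +_) (sym (*-identityˡ n)) ⟩
      suc t + 1 * n               ∎
      where
      open ≡-Reasoning
      regroup : ∀ jₙ r q → jₙ + suc r + q ≡ suc (jₙ + (r + q))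
      regroup = solve-∀
      swap : ∀ a b c → a + (b + c) ≡ b + (a + c)
      swap = solve-∀
    from-offset : (∃ λ i → offset n k i ≡ c) → ∃ λ i → pointMod n (jₙ + offset n k i) ≡ x
    from-offset (i , off≡c) = i , toℕ-injective (pointMod-≡ Q 1 (≤-trans (1≤offset i) (m≤n+m _ jₙ)) t<n
      (subst (λ o → jₙ + o + Q * n ≡ suc t + 1 * n) (sym off≡c) congruence))

  Pequi≡polygon : ∀ j → Pequi n k j ≡ polygon (phaseFin j)
  Pequi≡polygon j = trans (⋃-singletons≡image pequiPoint) (⊆-antisym image⊆polygon polygon⊆image)
    where
    pequiPoint : Fin k → Fin n
    pequiPoint i = pointMod n (toℕ j + offset n k i)
    image⊆polygon : image pequiPoint ⊆ polygon (phaseFin j)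
    image⊆polygon x∈ with ∈image⇒ pequiPoint x∈
    ... | i , refl = isVertex⇒∈polygon (phaseFin j) (pequiPoint i)
                       (subst (λ D → IsVertex D (toℕ (pequiPoint i))) (sym (toℕ-phaseFin j)) (pequiPoint-isVertex j i))
    polygon⊆image : polygon (phaseFin j) ⊆ image pequiPoint
    polygon⊆image {x} x∈ = subst (_∈ image pequiPoint) (proj₂ point) (∈image pequiPoint (proj₁ point))
      where
      point : ∃ λ i → pequiPoint i ≡ x
      point = isVertex⇒pequiPoint j x (subst (λ D → IsVertex D (toℕ x)) (toℕ-phaseFin j) (∈polygon⇒isVertex (phaseFin j) x∈))

  vertex<vertex : ∀ {D D′} m m′ → D + m * N + K ≤ D′ + m′ * N → vertex D m < vertex D′ m′
  vertex<vertex {D} {D′} m m′ le = subst (_≤ vertex D′ m′) (+-comm (vertex D m) 1)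
    (m+cn≤o⇒m/n+c≤o/n (D + m * N) 1 (D′ + m′ * N) (subst (λ x → D + m * N + x ≤ D′ + m′ * N) (sym (*-identityˡ K)) le))

  polygons-alternate : ∀ a b → toℕ a + K ≤ toℕ b → toℕ b + K ≤ toℕ a + N → Alternates {n} {k} (polygon a) (polygon b)
  polygons-alternate a b A+K≤B B+K≤A+N =
    vertexFin a , vertexFin b , image-enumerates (vertexFin-increasing a) , image-enumerates (vertexFin-increasing b) ,
    (λ i → subst₂ _<_ (sym (toℕ-vertexFin a i)) (sym (toℕ-vertexFin b i)) (vertex<vertex (toℕ i) (toℕ i) (begin
      A + toℕ i * N + K   ≡⟨ swap A (toℕ i * N) K ⟩
      A + K + toℕ i * N   ≤⟨ +-monoˡ-≤ (toℕ i * N) A+K≤B ⟩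
      B + toℕ i * N       ∎))) ,
    (λ i j j≡1+i → subst₂ _<_ (sym (toℕ-vertexFin b i)) (sym (toℕ-vertexFin a j)) (vertex<vertex (toℕ i) (toℕ j) (begin
      B + toℕ i * N + K   ≡⟨ swap B (toℕ i * N) K ⟩
      B + K + toℕ i * N   ≤⟨ +-monoˡ-≤ (toℕ i * N) B+K≤A+N ⟩
      A + N + toℕ i * N   ≡⟨ +-assoc A N (toℕ i * N) ⟩
      A + suc (toℕ i) * N ≡⟨ cong (λ m → A + m * N) (sym j≡1+i) ⟩
      A + toℕ j * N       ∎)))
    where
    open ≤-Reasoning
    A B : ℕ
    A = toℕ a
    B = toℕ b
    swap : ∀ x y z → x + y + z ≡ x + z + y
    swap = solve-∀

  module Circular (2K≤N : 2 * K ≤ N) (N≤n : N ≤ n) (inverse : InverseMod K N) where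

    open InverseMod inverse

    solution : ℕ → ℕ
    solution w = (w * u) % N

    solution-congruence : ∀ w → solution w * K + ((w * u) / N * K + w * α) * N ≡ w + w * β * N
    solution-congruence w = begin
      s * K + (q * K + w * α) * N   ≡⟨ regroup s q K w α N ⟩
      (s + q * N) * K + w * α * N   ≡⟨ cong (λ x → x * K + w * α * N) (sym (m≡m%n+[m/n]*n (w * u) N)) ⟩
      w * u * K + w * α * N         ≡⟨ factor w u K α N ⟩
      w * (u * K + α * N)           ≡⟨ cong (w *_) uK+αN≡1+βN ⟩
      w * (1 + β * N)               ≡⟨ expand w β N ⟩
      w + w * β * N                 ∎
      where
      open ≡-Reasoning
      s q : ℕ
      s = solution w
      q = (w * u) / N
      regroup : ∀ s q K w α N → s * K + (q * K + w * α) * N ≡ (s + q * N) * K + w * α * N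
      regroup = solve-∀
      factor : ∀ w u K α N → w * u * K + w * α * N ≡ w * (u * K + α * N)
      factor = solve-∀
      expand : ∀ w β N → w * (1 + β * N) ≡ w + w * β * N
      expand = solve-∀

    phaseInverse : Fin N → Fin n
    phaseInverse a = fromℕ< (<-≤-trans (m%n<n (suc (toℕ a) * u) N) N≤n)

    phaseFin-phaseInverse : ∀ a → phaseFin (phaseInverse a) ≡ a
    phaseFin-phaseInverse a = toℕ-injective (trans (toℕ-phaseFin (phaseInverse a))
      (m+kn≡o+ln⇒m%n≡o (j * K + pred N) A γ (suc (w * β)) congruence (toℕ<n a)))
      where
      A w : ℕ
      A = toℕ a
      w = suc A
      j<n : solution w < n
      j<n = <-≤-trans (m%n<n (w * u) N) N≤n
      j γ : ℕ
      j = toℕ (phaseInverse a)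
      γ = (w * u) / N * K + w * α
      congruence : j * K + pred N + γ * N ≡ A + suc (w * β) * N
      congruence = begin
        j * K + pred N + γ * N            ≡⟨ cong (λ x → x * K + pred N + γ * N) (toℕ-fromℕ< j<n) ⟩
        solution w * K + pred N + γ * N   ≡⟨ swap (solution w * K) (pred N) (γ * N) ⟩
        solution w * K + γ * N + pred N   ≡⟨ cong (_+ pred N) (solution-congruence w) ⟩
        suc A + w * β * N + pred N        ≡⟨ shuffle A (w * β * N) (pred N) ⟩
        A + (suc (pred N) + w * β * N)    ≡⟨ cong (λ x → A + (x + w * β * N)) (suc-pred N) ⟩
        A + (N + w * β * N)               ∎
        where
        open ≡-Reasoning
        swap : ∀ x y z → x + y + z ≡ x + z + y
        swap = solve-∀
        shuffle : ∀ A x p → suc A + x + p ≡ A + (suc p + x)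
        shuffle = solve-∀

    residue-hit : ∀ {L R} → L < N → R < N → ∃ λ (x : Fin n) → residue L (toℕ x) ≡ R
    residue-hit {L} {R} L<N R<N =
      x , trans (cong (λ y → (L + y * K) % N) n∸x≡d) (m+kn≡o+ln⇒m%n≡o (L + d * K) R γ (2 + w * β) congruence R<N)
      where
      w d γ : ℕ
      w = R + (N ∸ L) + (N ∸ K)
      d = suc (solution w)
      γ = (w * u) / N * K + w * α
      d≤n : d ≤ n
      d≤n = ≤-trans (m%n<n (w * u) N) N≤n
      n∸d<n : n ∸ d < n
      n∸d<n = ∸-monoʳ-< {n} {d} {0} (s≤s z≤n) d≤n
      x : Fin n
      x = fromℕ< n∸d<n
      n∸x≡d : n ∸ toℕ x ≡ d
      n∸x≡d = trans (cong (n ∸_) (toℕ-fromℕ< n∸d<n)) (m∸[m∸n]≡n d≤n)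
      congruence : L + d * K + γ * N ≡ R + (2 + w * β) * N
      congruence = begin
        L + d * K + γ * N                                ≡⟨ regroup L (solution w) K (γ * N) ⟩
        L + K + (solution w * K + γ * N)                 ≡⟨ cong (L + K +_) (solution-congruence w) ⟩
        L + K + (w + w * β * N)                          ≡⟨ shuffle L K R (N ∸ L) (N ∸ K) (w * β * N) ⟩
        R + (L + (N ∸ L)) + (K + (N ∸ K)) + w * β * N    ≡⟨ cong₂ (λ y y′ → R + y + y′ + w * β * N)
                                                                   (m+[n∸m]≡n (<⇒≤ L<N)) (m+[n∸m]≡n K≤N) ⟩
        R + N + N + w * β * N                            ≡⟨ collect R N (w * β) ⟩
        R + (2 + w * β) * N                              ∎
        where
        open ≡-Reasoning
        regroup : ∀ L s K g → L + suc s * K + g ≡ L + K + (s * K + g)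
        regroup = solve-∀
        shuffle : ∀ L K R a b c → L + K + (R + a + b + c) ≡ R + (L + a) + (K + b) + c
        shuffle = solve-∀
        collect : ∀ R N x → R + N + N + x * N ≡ R + (2 + x) * N
        collect = solve-∀

    residue-shift : ∀ {L H} δ c {R} → L < N → R < N → H + c * N ≡ δ + L → δ + R < N →
                    ∃ λ (x : Fin n) → residue L (toℕ x) ≡ R × residue H (toℕ x) ≡ δ + R
    residue-shift {L} {H} δ c {R} L<N R<N H+cN≡δ+L δ+R<N with residue-hit L<N R<N
    ... | x , resL≡R = x , resL≡R , m+kn≡o+ln⇒m%n≡o (H + sK) (δ + R) c γ congruence δ+R<N
      where
      sK γ : ℕ
      sK = (n ∸ toℕ x) * K
      γ = (L + sK) / N
      congruence : H + sK + c * N ≡ δ + R + γ * N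
      congruence = begin
        H + sK + c * N    ≡⟨ swap H sK (c * N) ⟩
        H + c * N + sK    ≡⟨ cong (_+ sK) H+cN≡δ+L ⟩
        δ + L + sK        ≡⟨ +-assoc δ L sK ⟩
        δ + (L + sK)      ≡⟨ cong (δ +_) (trans (m≡m%n+[m/n]*n (L + sK) N) (cong (_+ γ * N) resL≡R)) ⟩
        δ + (R + γ * N)   ≡⟨ sym (+-assoc δ R (γ * N)) ⟩
        δ + R + γ * N     ∎
        where
        open ≡-Reasoning
        swap : ∀ x y z → x + y + z ≡ x + z + y
        swap = solve-∀

    separating-vertex : ∀ {L H} → L < H → H < N → ∃ λ (x : Fin n) → IsVertex L (toℕ x) × ¬ IsVertex H (toℕ x)
    separating-vertex {L} {H} L<H H<N = separate (K ≤? δ)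
      where
      δ : ℕ
      δ = H ∸ L
      pred[K]<K : pred K < K
      pred[K]<K = ≤-reflexive (suc-pred K)
      separate-at : ∀ R → R < K → K ≤ δ + R → δ + R < N → ∃ λ (x : Fin n) → IsVertex L (toℕ x) × ¬ IsVertex H (toℕ x)
      separate-at R R<K K≤δ+R δ+R<N =
        let x , resL≡R , resH≡δ+R = residue-shift δ 0 (<-trans L<H H<N) (<-≤-trans R<K K≤N)
                                      (trans (+-identityʳ H) (sym (m∸n+n≡m (<⇒≤ L<H)))) δ+R<N
        in x , subst (_< K) (sym resL≡R) R<K , λ resH<K → <⇒≱ resH<K (subst (K ≤_) (sym resH≡δ+R) K≤δ+R)
      separate : Dec (K ≤ δ) → ∃ λ (x : Fin n) → IsVertex L (toℕ x) × ¬ IsVertex H (toℕ x)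
      separate (yes K≤δ) = separate-at 0 (>-nonZero⁻¹ K) (subst (K ≤_) (sym (+-identityʳ δ)) K≤δ)
                                       (subst (_< N) (sym (+-identityʳ δ)) (≤-<-trans (m∸n≤m H L) H<N))
      separate (no K≰δ) = separate-at (pred K) pred[K]<K
        (subst (_≤ δ + pred K) (suc-pred K) (+-monoˡ-≤ (pred K) (m<n⇒0<n∸m L<H)))
        (begin-strict
          δ + pred K        ≤⟨ +-monoˡ-≤ (pred K) (suc[m]≤n⇒m≤pred[n] (≰⇒> K≰δ)) ⟩
          pred K + pred K   <⟨ +-monoʳ-< (pred K) pred[K]<K ⟩
          pred K + K        ≤⟨ +-monoˡ-≤ K (<⇒≤ pred[K]<K) ⟩
          K + K             ≡⟨ cong (K +_) (sym (+-identityʳ K)) ⟩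
          2 * K             ≤⟨ 2K≤N ⟩
          N                 ∎)
        where open ≤-Reasoning

    shared-vertex : ∀ {L H} δ c → L < N → H + c * N ≡ δ + L → δ < K →
                    ∃ λ (x : Fin n) → IsVertex L (toℕ x) × IsVertex H (toℕ x)
    shared-vertex δ c L<N H+cN≡δ+L δ<K =
      let x , resL≡0 , resH≡δ+0 = residue-shift δ c L<N (>-nonZero⁻¹ N) H+cN≡δ+L
                                    (subst (_< N) (sym (+-identityʳ δ)) (<-≤-trans δ<K K≤N))
      in x , subst (_< K) (sym resL≡0) (>-nonZero⁻¹ K) , subst (_< K) (sym (trans resH≡δ+0 (+-identityʳ δ))) δ<K

    polygon-injective : ∀ a b → polygon a ≡ polygon b → a ≡ b
    polygon-injective a b pa≡pb with <-cmp (toℕ a) (toℕ b)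
    ... | tri≈ _ A≡B _ = toℕ-injective A≡B
    ... | tri< A<B _ _ =
      let x , isV , ¬isV = separating-vertex A<B (toℕ<n b)
      in contradiction (∈polygon⇒isVertex b (subst (x ∈_) pa≡pb (isVertex⇒∈polygon a x isV))) ¬isV
    ... | tri> _ _ B<A =
      let x , isV , ¬isV = separating-vertex B<A (toℕ<n a)
      in contradiction (∈polygon⇒isVertex a (subst (x ∈_) (sym pa≡pb) (isVertex⇒∈polygon b x isV))) ¬isV

    common-vertex : ∀ a b → toℕ a ≤ toℕ b → ¬ CircAdj {N} K a b → ∃ λ x → x ∈ polygon a × x ∈ polygon b
    common-vertex a b A≤B ¬adj with toℕ a + K ≤? toℕ b
    ... | no A+K≰B =
      let x , isV-A , isV-B = shared-vertex (B ∸ A) 0 (toℕ<n a) (trans (+-identityʳ B) (sym (m∸n+n≡m A≤B)))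
                                (+-cancelʳ-< A (B ∸ A) K (subst (_< K + A) (sym (m∸n+n≡m A≤B))
                                  (subst (B <_) (+-comm A K) (≰⇒> A+K≰B))))
      in x , isVertex⇒∈polygon a x isV-A , isVertex⇒∈polygon b x isV-B
      where
      A B : ℕ
      A = toℕ a
      B = toℕ b
    ... | yes A+K≤B =
      let x , isV-B , isV-A = shared-vertex (A + N ∸ B) 1 (toℕ<n b) (trans (cong (A +_) (+-identityʳ N)) (sym (m∸n+n≡m B≤A+N)))
                                (+-cancelʳ-< B (A + N ∸ B) K (subst (_< K + B) (sym (m∸n+n≡m B≤A+N))
                                  (subst (A + N <_) (+-comm B K) A+N<B+K)))
      in x , isVertex⇒∈polygon a x isV-A , isVertex⇒∈polygon b x isV-B
      where
      A B : ℕ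
      A = toℕ a
      B = toℕ b
      B≤A+N : B ≤ A + N
      B≤A+N = ≤-trans (<⇒≤ (toℕ<n b)) (m≤n+m N A)
      A+N<B+K : A + N < B + K
      A+N<B+K = ≰⇒> λ B+K≤A+N → ¬adj (Equivalence.from (≤cdist⇔ a b K A≤B) (A+K≤B , B+K≤A+N))

    interlace⇔adjacent-≤ : ∀ a b → toℕ a ≤ toℕ b → Interlace k (polygon a) (polygon b) ⇔ CircAdj {N} K a b
    interlace⇔adjacent-≤ a b A≤B = mk⇔ to from
      where
      to : Interlace k (polygon a) (polygon b) → CircAdj {N} K a b
      to interlaced = decidable-stable (K ≤? cdist a b) λ ¬adj →
        let x , x∈a , x∈b = common-vertex a b A≤B ¬adj
        in [ (λ alt → alternates⇒disjoint alt x∈a x∈b) , (λ alt → alternates⇒disjoint alt x∈b x∈a) ]′ interlaced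
      from : CircAdj {N} K a b → Interlace k (polygon a) (polygon b)
      from adj = inj₁ (uncurry (polygons-alternate a b) (Equivalence.to (≤cdist⇔ a b K A≤B) adj))

    interlace⇔adjacent : ∀ a b → Interlace k (polygon a) (polygon b) ⇔ CircAdj {N} K a b
    interlace⇔adjacent a b with ≤-total (toℕ a) (toℕ b)
    ... | inj₁ A≤B = interlace⇔adjacent-≤ a b A≤B
    ... | inj₂ B≤A = mk⇔ (λ interlaced → subst (K ≤_) (cdist-sym b a) (Equivalence.to ba (⊎-swap interlaced)))
                         (λ adj → ⊎-swap (Equivalence.from ba (subst (K ≤_) (cdist-sym a b) adj)))
      where
      ba : Interlace k (polygon b) (polygon a) ⇔ CircAdj {N} K b a
      ba = interlace⇔adjacent-≤ b a B≤A

    Pequi-phaseInverse : ∀ a → Pequi n k (phaseInverse a) ≡ polygon a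
    Pequi-phaseInverse a = trans (Pequi≡polygon (phaseInverse a)) (cong polygon (phaseFin-phaseInverse a))

proposition10 : (n k r n′ k′ : ℕ) → .{{_ : NonZero n}} → .{{_ : NonZero k}} →
    2 ≤ r → r * k ≤ n → 1 ≤ n′ → 1 ≤ k′ → gcd n′ k′ ≡ 1 → n * k′ ≡ n′ * k →
    (∀ (j : Fin n) → IsPolygon k (Pequi n k j) × Stable r (Pequi n k j)) ×
    Σ (Fin n′ → Fin n) λ φ →
      (∀ a b → Pequi n k (φ a) ≡ Pequi n k (φ b) → a ≡ b) ×
      (∀ (j : Fin n) → ∃ λ a → Pequi n k j ≡ Pequi n k (φ a)) ×
      (∀ a b → Interlace k (Pequi n k (φ a)) (Pequi n k (φ b)) ⇔ CircAdj {n′} k′ a b)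
proposition10 n k r n′ k′ 2≤r rk≤n 1≤n′ 1≤k′ gcd≡1 nk′≡n′k =
  (λ j → subst (IsPolygon k) (sym (Pequi≡polygon j)) (∣polygon∣≡k (phaseFin j)) ,
         subst (Stable r) (sym (Pequi≡polygon j)) (polygon-stable rk′≤n′ (phaseFin j))) ,
  phaseInverse ,
  (λ a b eq → polygon-injective a b (trans (sym (Pequi-phaseInverse a)) (trans eq (Pequi-phaseInverse b)))) ,
  (λ j → phaseFin j , trans (Pequi≡polygon j) (sym (Pequi-phaseInverse (phaseFin j)))) ,
  (λ a b → subst₂ (λ P Q → Interlace k P Q ⇔ CircAdj {n′} k′ a b)
                  (sym (Pequi-phaseInverse a)) (sym (Pequi-phaseInverse b)) (interlace⇔adjacent a b))
  where
  instance
    n′≢0 : NonZero n′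
    n′≢0 = >-nonZero 1≤n′
    k′≢0 : NonZero k′
    k′≢0 = >-nonZero 1≤k′
  coprime : Coprime n′ k′
  coprime = gcd≡1⇒coprime gcd≡1
  rk′≤n′ : r * k′ ≤ n′
  rk′≤n′ = rk≤n⇒rk′≤n′ r nk′≡n′k rk≤n
  2k′≤n′ : 2 * k′ ≤ n′
  2k′≤n′ = ≤-trans (*-monoˡ-≤ k′ 2≤r) rk′≤n′
  k′≤n′ : k′ ≤ n′
  k′≤n′ = ≤-trans (m≤m+n k′ (k′ + 0)) 2k′≤n′
  open EquiPolygons n k n′ k′ nk′≡n′k k′≤n′
  open Circular 2k′≤n′ (∣⇒≤ (coprime∧nk′≡n′k⇒n′∣n coprime nk′≡n′k)) (coprime⇒inverseMod coprime)
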